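{- Let $D_E$, $D_V$ be finite-dimensional of dimensions $m$ and $n$, with bases $(a_1,\dots,a_m)$ and $(b_1,\dots,b_n)$, and order the basis of $D_E\otimes D_V$ as $(a_1\otimes b_1,\dots,a_1\otimes b_n,\dots,a_m\otimes b_1,\dots,a_m\otimes b_n)$. Let $\phi$ be an endomorphism of $D_E\otimes D_V$ whose matrix in this basis is the block matrix $(A_{ij})_{1\leq i,j\leq m}$ with $A_{ij}\in M_n(\mathbb{K})$. Then: (1) $\phi$ is tree-compatible if and only if $A_{ij}A_{kl}=A_{kl}A_{ij}$ for all $i,j,k,l\in\{1,\dots,m\}$; (2) $\phi$ is the tensor product of an endomorphism of $D_E$ and an endomorphism of $D_V$ if and only if the family $(A_{ij})_{1\leq i,j\leq m}$ has rank at most $1$ (i.e. spans a subspace of $M_n(\mathbb{K})$ of dimension $\leq1$).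
   Context: $\mathbb{K}$ is a field of characteristic zero. For a linear $\phi$ on $D_E\otimes D_V$, with $\tau$ the flip of $D_E\otimes D_E$, set $\phi_{23}=\mathrm{Id}_{D_E}\otimes\phi$ and $\phi_{13}=(\tau\otimes\mathrm{Id}_{D_V})\circ(\mathrm{Id}_{D_E}\otimes\phi)\circ(\tau\otimes\mathrm{Id}_{D_V})$ on $D_E\otimes D_E\otimes D_V$; $\phi$ is tree-compatible if $\phi_{13}\circ\phi_{23}=\phi_{23}\circ\phi_{13}$. -}

module Defs where

open import Level using (Level; _⊔_; suc)
open import Data.Nat using (ℕ; zero) renaming (suc to sucℕ; _*_ to _*ℕ_)
open import Data.Fin using (Fin; _≟_; remQuot; combine) renaming (zero to fzero; suc to fsuc)
open import Data.Product using (Σ; ∃; _×_; _,_; proj₁; proj₂)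
open import Relation.Nullary using (¬_; yes; no)
open import Algebra.Bundles using (CommutativeRing)

record Field (c ℓ : Level) : Set (suc (c ⊔ ℓ)) where
  field
    commutativeRing : CommutativeRing c ℓ
  open CommutativeRing commutativeRing public
  field
    1≉0     : ¬ (1# ≈ 0#)
    inverse : ∀ x → ¬ (x ≈ 0#) → Σ Carrier (λ y → (x * y) ≈ 1#)

module _ {c ℓ} (K : Field c ℓ) where
  open Field K

  fromℕ : ℕ → Carrier
  fromℕ zero     = 0#
  fromℕ (sucℕ k) = 1# + fromℕ k

  CharZero : Set ℓ
  CharZero = ∀ k → ¬ (fromℕ (sucℕ k) ≈ 0#)

  Mat : ℕ → Set c
  Mat k = Fin k → Fin k → Carrier

  ∑ : (k : ℕ) → (Fin k → Carrier) → Carrier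
  ∑ zero     f = 0#
  ∑ (sucℕ k) f = f fzero + ∑ k (λ t → f (fsuc t))

  _·_ : ∀ {k} → Mat k → Mat k → Mat k
  _·_ {k} A B r s = ∑ k (λ t → A r t * B t s)

  _≈ₘ_ : ∀ {k} → Mat k → Mat k → Set ℓ
  A ≈ₘ B = ∀ r s → A r s ≈ B r s

  δ : ∀ {k} → Fin k → Fin k → Carrier
  δ i j with i ≟ j
  ... | yes _ = 1#
  ... | no  _ = 0#

  idMat : ∀ {k} → Mat k
  idMat = δ

  -- Kronecker product: matrix of f ⊗ g in the basis (a_1⊗b_1, …, a_1⊗b_n, …, a_m⊗b_n),
  -- where the basis vector a_i ⊗ b_p sits at position combine i p (= i·n + p).
  kron : ∀ {a b} → Mat a → Mat b → Mat (a *ℕ b)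
  kron {a} {b} F G r s with remQuot {a} b r | remQuot {a} b s
  ... | (i , p) | (j , q) = F i j * G p q

  -- The endomorphism φ of D_E ⊗ D_V (dim D_E = m, dim D_V = n) is given by its matrix
  -- M : Mat (m * n). Its (i,j) block A_ij ∈ M_n(K):
  block : ∀ m n → Mat (m *ℕ n) → Fin m → Fin m → Mat n
  block m n M i j p q = M (combine i p) (combine j q)

  -- D_E ⊗ D_E ⊗ D_V = D_E ⊗ (D_E ⊗ D_V), basis a_i ⊗ a_j ⊗ b_p ordered lexicographically.
  -- φ₂₃ = Id_{D_E} ⊗ φ
  φ₂₃ : ∀ m n → Mat (m *ℕ n) → Mat (m *ℕ (m *ℕ n))
  φ₂₃ m n M = kron {m} {m *ℕ n} idMat M

  -- matrix of τ ⊗ Id_{D_V} : a_i ⊗ a_j ⊗ b_p ↦ a_j ⊗ a_i ⊗ b_p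
  τ⊗Id : ∀ m n → Mat (m *ℕ (m *ℕ n))
  τ⊗Id m n r s with remQuot {m} (m *ℕ n) r | remQuot {m} (m *ℕ n) s
  ... | (i , u) | (i' , u') with remQuot {m} n u | remQuot {m} n u'
  ... | (j , p) | (j' , p') = δ i j' * (δ j i' * δ p p')

  φ₁₃ : ∀ m n → Mat (m *ℕ n) → Mat (m *ℕ (m *ℕ n))
  φ₁₃ m n M = τ⊗Id m n · (φ₂₃ m n M · τ⊗Id m n)

  TreeCompatible : ∀ m n → Mat (m *ℕ n) → Set ℓ
  TreeCompatible m n M = (φ₁₃ m n M · φ₂₃ m n M) ≈ₘ (φ₂₃ m n M · φ₁₃ m n M)

  IsTensorProduct : ∀ m n → Mat (m *ℕ n) → Set (c ⊔ ℓ)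
  IsTensorProduct m n M = Σ (Mat m) (λ F → Σ (Mat n) (λ G → M ≈ₘ kron {m} {n} F G))

  -- the family (A_ij) spans a subspace of M_n(K) of dimension ≤ 1:
  -- there is a single matrix B with every A_ij a scalar multiple of B
  RankAtMostOne : ∀ m n → (Fin m → Fin m → Mat n) → Set (c ⊔ ℓ)
  RankAtMostOne m n A =
    Σ (Mat n) (λ B → ∀ i j → Σ Carrier (λ λij → ∀ p q → A i j p q ≈ (λij * B p q)))

-- Index the basis of D_E ⊗ D_E ⊗ D_V by triples (i, j, p). Then Id ⊗ φ has entries
-- δ_ii' (A_jj')_pq and, conjugating by the flip, φ₁₃ has entries δ_jj' (A_ii')_pq. Hence the
-- (i i', j j') block of φ₁₃ φ₂₃ is A_ii' A_jj' and that of φ₂₃ φ₁₃ is A_jj' A_ii', which gives (1).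
-- The (i, j) block of f ⊗ g is f_ij g, so φ = f ⊗ g exactly when every A_ij is the multiple f_ij of
-- the single matrix g, which gives (2).
module Submission where

open import Defs
open import Data.Nat using (ℕ; zero; suc) renaming (_+_ to _+ℕ_; _*_ to _*ℕ_)
open import Data.Fin using (Fin; zero; suc; combine; remQuot; _↑ˡ_; _↑ʳ_; _≟_)
open import Data.Fin.Properties using (remQuot-combine; combine-remQuot; suc-injective)
open import Data.Product using (_×_; _,_; proj₁; proj₂)
open import Function using (_∘_; _⇔_; mk⇔)
open import Relation.Nullary using (yes; no; contradiction)
open import Relation.Binary.PropositionalEquality as ≡ using (_≡_; _≢_)
import Algebra.Properties.Semiring.Sum as SemiringSum
import Algebra.Solver.CommutativeMonoid as CommutativeMonoidSolver

module _ {c ℓ} (K : Field c ℓ) where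
  open Field K hiding (zero)
  open import Relation.Binary.Reasoning.Setoid setoid
  open SemiringSum semiring
    using (sum; sum-cong-≋; sum-cong-≗; sum-replicate-zero; *-distribˡ-sum)
    renaming (∑-comm to sum-comm)
  open CommutativeMonoidSolver *-commutativeMonoid using (solve; _⊕_; _⊜_)

  infixl 7 _∙_
  _∙_ : ∀ {k} → Mat K k → Mat K k → Mat K k
  _∙_ = _·_ K

  ∑≡sum : ∀ k (f : Fin k → Carrier) → ∑ K k f ≡ sum f
  ∑≡sum zero    f = ≡.refl
  ∑≡sum (suc k) f = ≡.cong (f zero +_) (∑≡sum k (f ∘ suc))

  ∑-cong : ∀ k {f g : Fin k → Carrier} → (∀ t → f t ≈ g t) → ∑ K k f ≈ ∑ K k g
  ∑-cong k {f} {g} f≈g = begin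
    ∑ K k f  ≡⟨ ∑≡sum k f ⟩
    sum f    ≈⟨ sum-cong-≋ f≈g ⟩
    sum g    ≡⟨ ∑≡sum k g ⟨
    ∑ K k g  ∎

  ∑-zero : ∀ k → ∑ K k (λ _ → 0#) ≈ 0#
  ∑-zero k = trans (reflexive (∑≡sum k _)) (sum-replicate-zero k)

  ∑-distribˡ : ∀ k x (f : Fin k → Carrier) → ∑ K k (λ t → x * f t) ≈ x * ∑ K k f
  ∑-distribˡ k x f = begin
    ∑ K k (λ t → x * f t)  ≡⟨ ∑≡sum k _ ⟩
    sum (λ t → x * f t)    ≈⟨ *-distribˡ-sum x f ⟨
    x * sum f              ≡⟨ ≡.cong (x *_) (∑≡sum k f) ⟨
    x * ∑ K k f            ∎

  ∑-comm : ∀ a b (f : Fin a → Fin b → Carrier) →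
           ∑ K a (λ i → ∑ K b (f i)) ≈ ∑ K b (λ j → ∑ K a (λ i → f i j))
  ∑-comm a b f = begin
    ∑ K a (λ i → ∑ K b (f i))            ≡⟨ ∑∑≡sum-sum a b f ⟩
    sum (λ i → sum (f i))                ≈⟨ sum-comm f ⟩
    sum (λ j → sum (λ i → f i j))        ≡⟨ ∑∑≡sum-sum b a (λ j i → f i j) ⟨
    ∑ K b (λ j → ∑ K a (λ i → f i j))    ∎
    where
    ∑∑≡sum-sum : ∀ a b (g : Fin a → Fin b → Carrier) →
                 ∑ K a (λ i → ∑ K b (g i)) ≡ sum (λ i → sum (g i))
    ∑∑≡sum-sum a b g = ≡.trans (∑≡sum a _) (sum-cong-≗ (λ i → ∑≡sum b (g i)))

  ∑-splitAt : ∀ a b (f : Fin (a +ℕ b) → Carrier) →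
              ∑ K (a +ℕ b) f ≈ ∑ K a (λ i → f (i ↑ˡ b)) + ∑ K b (λ j → f (a ↑ʳ j))
  ∑-splitAt zero    b f = sym (+-identityˡ _)
  ∑-splitAt (suc a) b f = trans (+-congˡ (∑-splitAt a b (f ∘ suc))) (sym (+-assoc _ _ _))

  ∑-combine : ∀ a b (f : Fin (a *ℕ b) → Carrier) →
              ∑ K (a *ℕ b) f ≈ ∑ K a (λ i → ∑ K b (λ p → f (combine i p)))
  ∑-combine zero    b f = refl
  ∑-combine (suc a) b f = trans (∑-splitAt b (a *ℕ b) f) (+-congˡ (∑-combine a b _))

  δ-≡ : ∀ {k} (a b : Fin k) → a ≡ b → δ K a b ≈ 1#
  δ-≡ a b a≡b with a ≟ b
  ... | yes _   = refl
  ... | no  a≢b = contradiction a≡b a≢b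

  δ-≢ : ∀ {k} (a b : Fin k) → a ≢ b → δ K a b ≈ 0#
  δ-≢ a b a≢b with a ≟ b
  ... | yes a≡b = contradiction a≡b a≢b
  ... | no  _   = refl

  δ-resp-⇔ : ∀ {k k′} (a b : Fin k) (a′ b′ : Fin k′) →
             (a ≡ b → a′ ≡ b′) → (a′ ≡ b′ → a ≡ b) → δ K a b ≈ δ K a′ b′
  δ-resp-⇔ a b a′ b′ to from with a ≟ b
  ... | yes a≡b = sym (δ-≡ a′ b′ (to a≡b))
  ... | no  a≢b = sym (δ-≢ a′ b′ (a≢b ∘ from))

  δ-sym : ∀ {k} (a b : Fin k) → δ K a b ≈ δ K b a
  δ-sym a b = δ-resp-⇔ a b b a ≡.sym ≡.sym

  δ-suc : ∀ {k} (a b : Fin k) → δ K (suc a) (suc b) ≈ δ K a b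
  δ-suc a b = δ-resp-⇔ (suc a) (suc b) a b suc-injective (≡.cong suc)

  ∑-δ : ∀ k (a : Fin k) (f : Fin k → Carrier) → ∑ K k (λ t → δ K a t * f t) ≈ f a
  ∑-δ (suc k) zero f = begin
    δ K {suc k} zero zero * f zero + ∑ K k (λ t → δ K zero (suc t) * f (suc t))
      ≈⟨ +-cong (*-congʳ (δ-≡ {suc k} zero zero ≡.refl))
                (∑-cong k (λ t → *-congʳ (δ-≢ zero (suc t) λ ()))) ⟩
    1# * f zero + ∑ K k (λ t → 0# * f (suc t))
      ≈⟨ +-cong (*-identityˡ _) (trans (∑-cong k (λ _ → zeroˡ _)) (∑-zero k)) ⟩
    f zero + 0#
      ≈⟨ +-identityʳ _ ⟩
    f zero ∎
  ∑-δ (suc k) (suc a) f = begin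
    δ K (suc a) zero * f zero + ∑ K k (λ t → δ K (suc a) (suc t) * f (suc t))
      ≈⟨ +-cong (*-congʳ (δ-≢ (suc a) zero λ ())) (∑-cong k (λ t → *-congʳ (δ-suc a t))) ⟩
    0# * f zero + ∑ K k (λ t → δ K a t * f (suc t))
      ≈⟨ +-cong (zeroˡ _) (∑-δ k a (f ∘ suc)) ⟩
    0# + f (suc a)
      ≈⟨ +-identityˡ _ ⟩
    f (suc a) ∎

  kron-combine : ∀ {a b} (F : Mat K a) (G : Mat K b) i p j q →
                 kron K F G (combine i p) (combine j q) ≡ F i j * G p q
  kron-combine {a} {b} F G i p j q =
    ≡.cong₂ (λ (i , p) (j , q) → F i j * G p q)
      (remQuot-combine {a} {b} i p) (remQuot-combine {a} {b} j q)

  combine-elim : ∀ {a b ℓ′} (P : Fin (a *ℕ b) → Set ℓ′) →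
                 (∀ (i : Fin a) (p : Fin b) → P (combine i p)) → ∀ r → P r
  combine-elim {a} {b} P P-combine r = ≡.subst P (combine-remQuot {a} b r) (P-combine _ _)

  ≈ₘ-combine : ∀ {a b} {X Y : Mat K (a *ℕ b)} →
               (∀ (i : Fin a) (p : Fin b) j q →
                  X (combine i p) (combine j q) ≈ Y (combine i p) (combine j q)) →
               _≈ₘ_ K X Y
  ≈ₘ-combine {a} {b} {X} {Y} X≈Y r s =
    combine-elim {a} {b} (λ r → X r s ≈ Y r s)
      (λ i p → combine-elim {a} {b} (λ s → X (combine i p) s ≈ Y (combine i p) s) (X≈Y i p) s) r

  isTensorProduct⇔rankAtMostOne : ∀ m n (M : Mat K (m *ℕ n)) →
    IsTensorProduct K m n M ⇔ RankAtMostOne K m n (block K m n M)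
  isTensorProduct⇔rankAtMostOne m n M = mk⇔ blocks-proportional tensor-of-coefficients
    where
    blocks-proportional : IsTensorProduct K m n M → RankAtMostOne K m n (block K m n M)
    blocks-proportional (F , G , M≈F⊗G) =
      G , λ i j → F i j , λ p q →
        trans (M≈F⊗G (combine i p) (combine j q)) (reflexive (kron-combine F G i p j q))

    tensor-of-coefficients : RankAtMostOne K m n (block K m n M) → IsTensorProduct K m n M
    tensor-of-coefficients (B , A≈λB) = F , B , ≈ₘ-combine λ i p j q →
        trans (proj₂ (A≈λB i j) p q) (sym (reflexive (kron-combine F B i p j q)))
      where
      F : Mat K m
      F i j = proj₁ (A≈λB i j)

  module TripleIndex (m n : ℕ) where

    ⟨_,_,_⟩ : Fin m → Fin m → Fin n → Fin (m *ℕ (m *ℕ n))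
    ⟨ i , j , p ⟩ = combine i (combine j p)

    ∑₃ : (Fin m → Fin m → Fin n → Carrier) → Carrier
    ∑₃ g = ∑ K m λ k → ∑ K m λ l → ∑ K n (g k l)

    ∑₃-cong : ∀ {f g : Fin m → Fin m → Fin n → Carrier} →
              (∀ k l u → f k l u ≈ g k l u) → ∑₃ f ≈ ∑₃ g
    ∑₃-cong f≈g = ∑-cong m λ k → ∑-cong m λ l → ∑-cong n (f≈g k l)

    ∙-triple : ∀ (X Y : Mat K (m *ℕ (m *ℕ n))) r s →
               (X ∙ Y) r s ≈ ∑₃ (λ k l u → X r ⟨ k , l , u ⟩ * Y ⟨ k , l , u ⟩ s)
    ∙-triple X Y r s = trans (∑-combine m (m *ℕ n) _) (∑-cong m λ k → ∑-combine m n _)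

    triple-elim : ∀ {ℓ′} (P : Fin (m *ℕ (m *ℕ n)) → Set ℓ′) →
                  (∀ i j p → P ⟨ i , j , p ⟩) → ∀ r → P r
    triple-elim P P-triple =
      combine-elim {m} {m *ℕ n} P λ i → combine-elim {m} {n} (P ∘ combine i) (P-triple i)

    ≈ₘ-triple : ∀ {X Y : Mat K (m *ℕ (m *ℕ n))} →
                (∀ i j p i′ j′ q →
                   X ⟨ i , j , p ⟩ ⟨ i′ , j′ , q ⟩ ≈ Y ⟨ i , j , p ⟩ ⟨ i′ , j′ , q ⟩) →
                _≈ₘ_ K X Y
    ≈ₘ-triple {X} {Y} X≈Y r s =
      triple-elim (λ r → X r s ≈ Y r s)
        (λ i j p → triple-elim (λ s → X ⟨ i , j , p ⟩ s ≈ Y ⟨ i , j , p ⟩ s) (X≈Y i j p) s) r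

    ∑₃-δδ : ∀ a b (g : Fin m → Fin m → Fin n → Carrier) →
            ∑₃ (λ k l u → δ K a k * (δ K b l * g k l u)) ≈ ∑ K n (g a b)
    ∑₃-δδ a b g = begin
      ∑₃ (λ k l u → δ K a k * (δ K b l * g k l u))
        ≈⟨ ∑-cong m (λ k → ∑-cong m λ l →
             trans (∑-distribˡ n _ _) (*-congˡ (∑-distribˡ n _ _))) ⟩
      ∑ K m (λ k → ∑ K m λ l → δ K a k * (δ K b l * ∑ K n (g k l)))
        ≈⟨ ∑-cong m (λ k → trans (∑-distribˡ m _ _) (*-congˡ (∑-δ m b _))) ⟩
      ∑ K m (λ k → δ K a k * ∑ K n (g k b))
        ≈⟨ ∑-δ m a _ ⟩
      ∑ K n (g a b) ∎

    ∑₃-δδδ : ∀ a b e (g : Fin m → Fin m → Fin n → Carrier) →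
             ∑₃ (λ k l u → δ K a k * (δ K b l * (δ K e u * g k l u))) ≈ g a b e
    ∑₃-δδδ a b e g = trans (∑₃-δδ a b _) (∑-δ n e _)

  module TreeCompatibility {m n : ℕ} (M : Mat K (m *ℕ n)) where
    open TripleIndex m n

    A : Fin m → Fin m → Mat K n
    A = block K m n M

    Φ₂₃ Φ₁₃ T : Mat K (m *ℕ (m *ℕ n))
    Φ₂₃ = φ₂₃ K m n M
    Φ₁₃ = φ₁₃ K m n M
    T   = τ⊗Id K m n

    φ₂₃-entry : ∀ i j p i′ j′ q → Φ₂₃ ⟨ i , j , p ⟩ ⟨ i′ , j′ , q ⟩ ≈ δ K i i′ * A j j′ p q
    φ₂₃-entry i j p i′ j′ q = reflexive (kron-combine (idMat K) M i (combine j p) i′ (combine j′ q))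

    τ-entry : ∀ i j p i′ j′ q →
              T ⟨ i , j , p ⟩ ⟨ i′ , j′ , q ⟩ ≡ δ K i j′ * (δ K j i′ * δ K p q)
    τ-entry i j p i′ j′ q = ≡.trans
      (≡.cong₂ (λ (i , u) (i′ , u′) → let (j , p) = remQuot {m} n u ; (j′ , q) = remQuot {m} n u′
                                       in δ K i j′ * (δ K j i′ * δ K p q))
        (remQuot-combine {m} {m *ℕ n} i (combine j p)) (remQuot-combine {m} {m *ℕ n} i′ (combine j′ q)))
      (≡.cong₂ (λ (j , p) (j′ , q) → δ K i j′ * (δ K j i′ * δ K p q))
        (remQuot-combine {m} {n} j p) (remQuot-combine {m} {n} j′ q))

    φ₂₃∙τ-entry : ∀ i j p i′ j′ q →
                  (Φ₂₃ ∙ T) ⟨ i , j , p ⟩ ⟨ i′ , j′ , q ⟩ ≈ δ K i j′ * A j i′ p q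
    φ₂₃∙τ-entry i j p i′ j′ q = begin
      (Φ₂₃ ∙ T) ⟨ i , j , p ⟩ ⟨ i′ , j′ , q ⟩
        ≈⟨ ∙-triple (Φ₂₃) (T) _ _ ⟩
      ∑₃ (λ k l u → Φ₂₃ ⟨ i , j , p ⟩ ⟨ k , l , u ⟩ * T ⟨ k , l , u ⟩ ⟨ i′ , j′ , q ⟩)
        ≈⟨ ∑₃-cong (λ k l u → *-cong (φ₂₃-entry i j p k l u) (reflexive (τ-entry k l u i′ j′ q))) ⟩
      ∑₃ (λ k l u → (δ K i k * A j l p u) * (δ K k j′ * (δ K l i′ * δ K u q)))
        ≈⟨ ∑₃-cong (λ k l u → *-congˡ (*-congˡ (*-cong (δ-sym l i′) (δ-sym u q)))) ⟩
      ∑₃ (λ k l u → (δ K i k * A j l p u) * (δ K k j′ * (δ K i′ l * δ K q u)))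
        ≈⟨ ∑₃-cong (λ k l u →
             solve 5 (λ a b c d e → (a ⊕ b) ⊕ (c ⊕ (d ⊕ e)) ⊜ a ⊕ (d ⊕ (e ⊕ (b ⊕ c)))) refl
               (δ K i k) (A j l p u) (δ K k j′) (δ K i′ l) (δ K q u)) ⟩
      ∑₃ (λ k l u → δ K i k * (δ K i′ l * (δ K q u * (A j l p u * δ K k j′))))
        ≈⟨ ∑₃-δδδ i i′ q _ ⟩
      A j i′ p q * δ K i j′
        ≈⟨ *-comm _ _ ⟩
      δ K i j′ * A j i′ p q ∎

    φ₁₃-entry : ∀ i j p i′ j′ q → Φ₁₃ ⟨ i , j , p ⟩ ⟨ i′ , j′ , q ⟩ ≈ δ K j j′ * A i i′ p q
    φ₁₃-entry i j p i′ j′ q = begin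
      Φ₁₃ ⟨ i , j , p ⟩ ⟨ i′ , j′ , q ⟩
        ≈⟨ ∙-triple (T) (Φ₂₃ ∙ T) _ _ ⟩
      ∑₃ (λ k l u → T ⟨ i , j , p ⟩ ⟨ k , l , u ⟩ *
                    (Φ₂₃ ∙ T) ⟨ k , l , u ⟩ ⟨ i′ , j′ , q ⟩)
        ≈⟨ ∑₃-cong (λ k l u → *-cong (reflexive (τ-entry i j p k l u)) (φ₂₃∙τ-entry k l u i′ j′ q)) ⟩
      ∑₃ (λ k l u → (δ K i l * (δ K j k * δ K p u)) * (δ K k j′ * A l i′ u q))
        ≈⟨ ∑₃-cong (λ k l u →
             solve 5 (λ a b c d e → (a ⊕ (b ⊕ c)) ⊕ (d ⊕ e) ⊜ b ⊕ (a ⊕ (c ⊕ (d ⊕ e)))) refl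
               (δ K i l) (δ K j k) (δ K p u) (δ K k j′) (A l i′ u q)) ⟩
      ∑₃ (λ k l u → δ K j k * (δ K i l * (δ K p u * (δ K k j′ * A l i′ u q))))
        ≈⟨ ∑₃-δδδ j i p _ ⟩
      δ K j j′ * A i i′ p q ∎

    φ₁₃∙φ₂₃-entry : ∀ i j p i′ j′ q →
                    (Φ₁₃ ∙ Φ₂₃) ⟨ i , j , p ⟩ ⟨ i′ , j′ , q ⟩ ≈ (A i i′ ∙ A j j′) p q
    φ₁₃∙φ₂₃-entry i j p i′ j′ q = begin
      (Φ₁₃ ∙ Φ₂₃) ⟨ i , j , p ⟩ ⟨ i′ , j′ , q ⟩
        ≈⟨ ∙-triple (Φ₁₃) (Φ₂₃) _ _ ⟩
      ∑₃ (λ k l u → Φ₁₃ ⟨ i , j , p ⟩ ⟨ k , l , u ⟩ * Φ₂₃ ⟨ k , l , u ⟩ ⟨ i′ , j′ , q ⟩)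
        ≈⟨ ∑₃-cong (λ k l u → *-cong (φ₁₃-entry i j p k l u)
                                     (trans (φ₂₃-entry k l u i′ j′ q) (*-congʳ (δ-sym k i′)))) ⟩
      ∑₃ (λ k l u → (δ K j l * A i k p u) * (δ K i′ k * A l j′ u q))
        ≈⟨ ∑₃-cong (λ k l u →
             solve 4 (λ a b c d → (a ⊕ b) ⊕ (c ⊕ d) ⊜ c ⊕ (a ⊕ (b ⊕ d))) refl
               (δ K j l) (A i k p u) (δ K i′ k) (A l j′ u q)) ⟩
      ∑₃ (λ k l u → δ K i′ k * (δ K j l * (A i k p u * A l j′ u q)))
        ≈⟨ ∑₃-δδ i′ j _ ⟩
      (A i i′ ∙ A j j′) p q ∎

    φ₂₃∙φ₁₃-entry : ∀ i j p i′ j′ q →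
                    (Φ₂₃ ∙ Φ₁₃) ⟨ i , j , p ⟩ ⟨ i′ , j′ , q ⟩ ≈ (A j j′ ∙ A i i′) p q
    φ₂₃∙φ₁₃-entry i j p i′ j′ q = begin
      (Φ₂₃ ∙ Φ₁₃) ⟨ i , j , p ⟩ ⟨ i′ , j′ , q ⟩
        ≈⟨ ∙-triple (Φ₂₃) (Φ₁₃) _ _ ⟩
      ∑₃ (λ k l u → Φ₂₃ ⟨ i , j , p ⟩ ⟨ k , l , u ⟩ * Φ₁₃ ⟨ k , l , u ⟩ ⟨ i′ , j′ , q ⟩)
        ≈⟨ ∑₃-cong (λ k l u → *-cong (φ₂₃-entry i j p k l u)
                                     (trans (φ₁₃-entry k l u i′ j′ q) (*-congʳ (δ-sym l j′)))) ⟩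
      ∑₃ (λ k l u → (δ K i k * A j l p u) * (δ K j′ l * A k i′ u q))
        ≈⟨ ∑₃-cong (λ k l u →
             solve 4 (λ a b c d → (a ⊕ b) ⊕ (c ⊕ d) ⊜ a ⊕ (c ⊕ (b ⊕ d))) refl
               (δ K i k) (A j l p u) (δ K j′ l) (A k i′ u q)) ⟩
      ∑₃ (λ k l u → δ K i k * (δ K j′ l * (A j l p u * A k i′ u q)))
        ≈⟨ ∑₃-δδ i j′ _ ⟩
      (A j j′ ∙ A i i′) p q ∎

    treeCompatible⇔blocksCommute :
      TreeCompatible K m n M ⇔ (∀ i j k l → _≈ₘ_ K (A i j ∙ A k l) (A k l ∙ A i j))
    treeCompatible⇔blocksCommute = mk⇔ blocks-commute tree-compatible
      where
      blocks-commute : TreeCompatible K m n M → ∀ i j k l → _≈ₘ_ K (A i j ∙ A k l) (A k l ∙ A i j)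
      blocks-commute φ₁₃φ₂₃≈φ₂₃φ₁₃ i j k l p q = begin
        (A i j ∙ A k l) p q                        ≈⟨ φ₁₃∙φ₂₃-entry i k p j l q ⟨
        (Φ₁₃ ∙ Φ₂₃) ⟨ i , k , p ⟩ ⟨ j , l , q ⟩    ≈⟨ φ₁₃φ₂₃≈φ₂₃φ₁₃ _ _ ⟩
        (Φ₂₃ ∙ Φ₁₃) ⟨ i , k , p ⟩ ⟨ j , l , q ⟩    ≈⟨ φ₂₃∙φ₁₃-entry i k p j l q ⟩
        (A k l ∙ A i j) p q                        ∎

      tree-compatible : (∀ i j k l → _≈ₘ_ K (A i j ∙ A k l) (A k l ∙ A i j)) →
                        TreeCompatible K m n M
      tree-compatible blocks-commute = ≈ₘ-triple λ i j p i′ j′ q → begin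
        (Φ₁₃ ∙ Φ₂₃) ⟨ i , j , p ⟩ ⟨ i′ , j′ , q ⟩  ≈⟨ φ₁₃∙φ₂₃-entry i j p i′ j′ q ⟩
        (A i i′ ∙ A j j′) p q                      ≈⟨ blocks-commute i i′ j j′ p q ⟩
        (A j j′ ∙ A i i′) p q                      ≈⟨ φ₂₃∙φ₁₃-entry i j p i′ j′ q ⟨
        (Φ₂₃ ∙ Φ₁₃) ⟨ i , j , p ⟩ ⟨ i′ , j′ , q ⟩  ∎

proposition4p13 : ∀ {c ℓ} (K : Field c ℓ) → CharZero K →
    (m n : ℕ) (M : Mat K (m *ℕ n)) →
    (TreeCompatible K m n M ⇔
      (∀ i j k l → _≈ₘ_ K (_·_ K (block K m n M i j) (block K m n M k l))
                          (_·_ K (block K m n M k l) (block K m n M i j))))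
    × (IsTensorProduct K m n M ⇔ RankAtMostOne K m n (block K m n M))
proposition4p13 K _ m n M =
  TreeCompatibility.treeCompatible⇔blocksCommute K M , isTensorProduct⇔rankAtMostOne K m n M
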